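{- Let $G$ be a graph, $R \subseteq V(G)$ a set of terminals with $|R|\ge 2$, and $G'$ any subdivision of $G$ (so $R \subseteq V(G')$). Let $T_1,\dots,T_k$ be trees in $G$, and for each $i\in[k]$ let $T_i'$ be the tree of $G'$ obtained from $T_i$ by subdividing its edges exactly as they are subdivided in $G'$. Then $\{T_1,\dots,T_k\}$ is an $R$-CIST of $G$ if and only if $\{T_1',\dots,T_k'\}$ is an $R$-CIST of $G'$.
   Context: Graphs are finite and connected, may have parallel edges but no loops. For a tree $T$, a vertex $v\in V(T)$ is an internal node if $d_T(v)\ge 2$ and a leaf otherwise; $L(T)$ is the set of leaves. For $R\subseteq V(G)$ with $|R|\ge 2$, an $R$-Steiner tree is a subtree $T$ of $G$ with $R\subseteq V(T)$ and $L(T)\subseteq R$. For $u,v\in V(T)$, $T(u,v)$ is the unique $(u,v)$-path in $T$. An $R$-CIST of $G$ is a set $\{T_1,\dots,T_k\}$ of $R$-Steiner trees such that for every pair of distinct $u,v\in R$ and all distinct $i,j\in[k]$, the paths $T_i(u,v)$ and $T_j(u,v)$ are edge-disjoint and internally vertex-disjoint (share no vertices other than $u,v$). -}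

module Defs where

open import Data.Nat using (ℕ; zero; suc; _<?_)
open import Data.Fin using (Fin; fromℕ<; toℕ)
open import Data.Product using (Σ; ∃; _×_; _,_; proj₁; proj₂)
open import Data.Sum using (_⊎_; inj₁; inj₂)
open import Data.Empty using (⊥)
open import Data.List using (List; []; _∷_)
open import Data.List.Relation.Unary.All using (All)
open import Data.List.Relation.Unary.Unique.Propositional using (Unique)
open import Data.List.Membership.Propositional using (_∈_; _∉_)
open import Relation.Nullary using (¬_; yes; no)
open import Relation.Binary.PropositionalEquality using (_≡_; _≢_)

record Graph (V E : Set) : Set where
  field
    ends : E → V × V
open Graph public

module _ {V E : Set} (G : Graph V E) where

  Loopless : Set
  Loopless = ∀ e → proj₁ (ends G e) ≢ proj₂ (ends G e)

  Joins : E → V → V → Set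
  Joins e u w = ends G e ≡ (u , w) ⊎ ends G e ≡ (w , u)

  Incident : E → V → Set
  Incident e v = proj₁ (ends G e) ≡ v ⊎ proj₂ (ends G e) ≡ v

  data Walk : V → V → Set where
    stop : ∀ {u} → Walk u u
    step : ∀ {u w v} (e : E) → Joins e u w → Walk w v → Walk u v

  verts : ∀ {u v} → Walk u v → List V
  verts {u} stop = u ∷ []
  verts {u} (step e _ p) = u ∷ verts p

  edgesOf : ∀ {u v} → Walk u v → List E
  edgesOf stop = []
  edgesOf (step e _ p) = e ∷ edgesOf p

  IsPath : ∀ {u v} → Walk u v → Set
  IsPath p = Unique (verts p)

  Connected : Set
  Connected = ∀ u v → Walk u v

record Subgraph (V E : Set) : Set₁ where
  field
    vs : V → Set
    es : E → Set
open Subgraph public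

module _ {V E : Set} (G : Graph V E) where

  InSub : Subgraph V E → ∀ {u v} → Walk G u v → Set
  InSub S p = All (vs S) (verts G p) × All (es S) (edgesOf G p)

  HasCycle : Subgraph V E → Set
  HasCycle S = Σ V λ u → Σ V λ w → Σ E λ e → Joins G e u w ×
    Σ (Walk G w u) λ p → es S e × InSub S p × IsPath G p × e ∉ edgesOf G p

  record IsTree (S : Subgraph V E) : Set where
    field
      closed    : ∀ e → es S e → vs S (proj₁ (ends G e)) × vs S (proj₂ (ends G e))
      nonempty  : ∃ λ v → vs S v
      connected : ∀ u v → vs S u → vs S v → Σ (Walk G u v) (InSub S)
      acyclic   : ¬ HasCycle S

  -- v is an internal node of S : d_S(v) ≥ 2, i.e. two distinct edges of S at v
  Internal : Subgraph V E → V → Set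
  Internal S v = Σ E λ e₁ → Σ E λ e₂ → e₁ ≢ e₂ × es S e₁ × es S e₂ ×
    Incident G e₁ v × Incident G e₂ v

  IsSteinerTree : (V → Set) → Subgraph V E → Set
  IsSteinerTree R S = IsTree S × (∀ v → R v → vs S v) ×
    (∀ v → vs S v → ¬ Internal S v → R v)

  IsCIST : (V → Set) → (k : ℕ) → (Fin k → Subgraph V E) → Set
  IsCIST R k T = (∀ i → IsSteinerTree R (T i)) ×
    (∀ u v → R u → R v → u ≢ v → ∀ i j → i ≢ j →
      (P Q : Walk G u v) → IsPath G P → InSub (T i) P → IsPath G Q → InSub (T j) Q →
      (∀ e → e ∈ edgesOf G P → e ∈ edgesOf G Q → ⊥) ×
      (∀ x → x ∈ verts G P → x ∈ verts G Q → x ≡ u ⊎ x ≡ v))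

AtLeastTwo : {V : Set} → (V → Set) → Set
AtLeastTwo {V} R = Σ V λ u → Σ V λ v → u ≢ v × R u × R v

-- Subdivision: edge e of G is replaced by a path with s e new inner vertices.

module _ {V E : Set} (s : E → ℕ) where

  SubV : Set
  SubV = V ⊎ Σ E (λ e → Fin (s e))

  SubE : Set
  SubE = Σ E (λ e → Fin (suc (s e)))

  -- j-th point (0 ≤ j ≤ s e + 1) along the subdivided edge e with ends (a , b)
  point : (e : E) → V × V → ℕ → SubV
  point e (a , b) zero = inj₁ a
  point e (a , b) (suc j) with j <? s e
  ... | yes j<s = inj₂ (e , fromℕ< j<s)
  ... | no _ = inj₁ b

  subdivide : Graph V E → Graph SubV SubE
  subdivide G .ends (e , j) =
    point e (ends G e) (toℕ j) , point e (ends G e) (suc (toℕ j))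

  subdivideSub : Subgraph V E → Subgraph SubV SubE
  subdivideSub T .vs (inj₁ v) = vs T v
  subdivideSub T .vs (inj₂ (e , _)) = es T e
  subdivideSub T .es (e , _) = es T e

  liftR : (V → Set) → SubV → Set
  liftR R (inj₁ v) = R v
  liftR R (inj₂ _) = ⊥

{-# OPTIONS --safe #-}
module Submission where

-- Inner vertices of a subdivided edge have degree 2 in G'. Hence a path of G'
-- that leaves an original vertex into the subdivision of an edge e cannot turn
-- back and must run through all of it to the other end of e. Consequently the
-- paths of G' between original vertices are exactly the subdivisions of paths
-- of G: they visit the same original vertices, and they meet a subdivision
-- vertex or edge of e precisely when the path of G uses e, in which case they
-- use every edge of the subdivision of e. Both CIST conditions transfer along
-- this correspondence, in either direction. The subdivided trees are trees:
-- walks lift, and a cycle through a subdivision edge of e contracts to a cycle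
-- through e.

open import Defs
open import Data.Nat using (ℕ; zero; suc; _≤_; _<_; z≤n; s≤s; _<?_)
open import Data.Nat.Properties
  using ( ≤-refl; ≤-trans; ≤-pred; <⇒≤; <⇒≢; <-irrefl; ≤⇒≯; n≤1+n; m≤n⇒m≤1+n; m≤n⇒m<n∨m≡n
        ; suc-injective)
open import Data.Nat.Induction using (<-wellFounded)
open import Data.Fin using (Fin; zero; suc; toℕ; fromℕ<; fromℕ; inject₁)
open import Data.Fin.Properties
  using (toℕ<n; toℕ≤pred[n]; toℕ-injective; toℕ-fromℕ<; fromℕ<-toℕ; toℕ-fromℕ; toℕ-inject₁)
open import Data.Product using (Σ; ∃; _×_; _,_; proj₁; proj₂)
open import Data.Sum as Sum using (_⊎_; inj₁; inj₂; [_,_]′; swap)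
open import Data.Sum.Properties using (inj₁-injective)
open import Data.Empty using (⊥; ⊥-elim)
open import Data.List using (List; []; _∷_; _++_; [_]; reverse; length)
open import Data.List.Properties using (unfold-reverse)
open import Data.List.Relation.Unary.All as All using (All; []; _∷_)
open import Data.List.Relation.Unary.All.Properties as All using (anti-mono; ¬Any⇒All¬)
open import Data.List.Relation.Unary.Any using (here; there)
open import Data.List.Relation.Unary.Any.Properties as Any using ()
open import Data.List.Relation.Unary.AllPairs using ([]; _∷_)
open import Data.List.Relation.Unary.Unique.Propositional using (Unique)
open import Data.List.Relation.Unary.Unique.Propositional.Properties as Unique using (Unique[x∷xs]⇒x∉xs)
open import Data.List.Membership.Propositional using (_∈_; _∉_)
open import Data.List.Membership.Propositional.Properties using (∈-++⁺ˡ; ∈-++⁻)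
open import Data.List.Relation.Binary.Subset.Propositional using (_⊆_)
open import Function using (_∘_)
open import Function.Bundles using (_⇔_; mk⇔)
open import Induction.WellFounded using (Acc; acc)
open import Relation.Nullary using (yes; no; contradiction)
open import Relation.Binary.PropositionalEquality
  using (_≡_; _≢_; refl; sym; trans; cong; subst; module ≡-Reasoning)

Unique-reverse : ∀ {A : Set} (xs : List A) → Unique xs → Unique (reverse xs)
Unique-reverse [] _ = []
Unique-reverse (x ∷ xs) u@(_ ∷ xs!) rewrite unfold-reverse x xs =
  Unique.++⁺ (Unique-reverse xs xs!) ([] ∷ [])
    λ { (x∈ , here refl) → Unique[x∷xs]⇒x∉xs u (Any.reverse⁻ x∈) }

module _ {V E : Set} (H : Graph V E) where

  Joins-Incident : ∀ {e x z} → Joins H e x z → Incident H e x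
  Joins-Incident (inj₁ refl) = inj₁ refl
  Joins-Incident (inj₂ refl) = inj₂ refl

  Incident-Joins : ∀ {e x z v} → Joins H e x z → Incident H e v → v ≡ x ⊎ v ≡ z
  Incident-Joins (inj₁ refl) (inj₁ refl) = inj₁ refl
  Incident-Joins (inj₁ refl) (inj₂ refl) = inj₂ refl
  Incident-Joins (inj₂ refl) (inj₁ refl) = inj₂ refl
  Incident-Joins (inj₂ refl) (inj₂ refl) = inj₁ refl

module _ {V E : Set} {H : Graph V E} where

  start∈verts : ∀ {u v} (p : Walk H u v) → u ∈ verts H p
  start∈verts stop = here refl
  start∈verts (step _ _ _) = here refl

  end∈verts : ∀ {u v} (p : Walk H u v) → v ∈ verts H p
  end∈verts stop = here refl
  end∈verts (step _ _ p) = there (end∈verts p)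

  ends∈verts : ∀ {u v} (p : Walk H u v) {e} → e ∈ edgesOf H p →
    proj₁ (ends H e) ∈ verts H p × proj₂ (ends H e) ∈ verts H p
  ends∈verts (step e (inj₁ refl) p) (here refl) = here refl , there (start∈verts p)
  ends∈verts (step e (inj₂ refl) p) (here refl) = there (start∈verts p) , here refl
  ends∈verts (step _ _ p) (there e∈) with ends∈verts p e∈
  ... | ∈₁ , ∈₂ = there ∈₁ , there ∈₂

  Joins-∈verts : ∀ {e x z u v} (p : Walk H u v) → Joins H e x z → e ∈ edgesOf H p → x ∈ verts H p
  Joins-∈verts p (inj₁ refl) = proj₁ ∘ ends∈verts p
  Joins-∈verts p (inj₂ refl) = proj₂ ∘ ends∈verts p

  InSub-mono : ∀ {S u v u₁ v₁} {p : Walk H u v} {q : Walk H u₁ v₁} →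
    verts H q ⊆ verts H p → edgesOf H q ⊆ edgesOf H p → InSub H S p → InSub H S q
  InSub-mono ⊆ᵛ ⊆ᵉ (p-vs , p-es) = anti-mono ⊆ᵛ p-vs , anti-mono ⊆ᵉ p-es

  infixr 5 _++ʷ_
  _++ʷ_ : ∀ {u v w} → Walk H u v → Walk H v w → Walk H u w
  stop ++ʷ q = q
  step e J p ++ʷ q = step e J (p ++ʷ q)

  edgesOf-++ʷ : ∀ {u v w} (p : Walk H u v) (q : Walk H v w) →
    edgesOf H (p ++ʷ q) ≡ edgesOf H p ++ edgesOf H q
  edgesOf-++ʷ stop q = refl
  edgesOf-++ʷ (step e _ p) q = cong (e ∷_) (edgesOf-++ʷ p q)

  ∈-verts-++ʷ⁻ : ∀ {u v w x} (p : Walk H u v) (q : Walk H v w) →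
    x ∈ verts H (p ++ʷ q) → x ∈ verts H p ⊎ x ∈ verts H q
  ∈-verts-++ʷ⁻ stop q x∈ = inj₂ x∈
  ∈-verts-++ʷ⁻ (step _ _ p) q (here refl) = inj₁ (here refl)
  ∈-verts-++ʷ⁻ (step _ _ p) q (there x∈) with ∈-verts-++ʷ⁻ p q x∈
  ... | inj₁ x∈p = inj₁ (there x∈p)
  ... | inj₂ x∈q = inj₂ x∈q

  ++ʷ-isPath : ∀ {u v w} (p : Walk H u v) (q : Walk H v w) → IsPath H p → IsPath H q →
    (∀ {x} → x ∈ verts H p → x ∈ verts H q → x ≡ v) → IsPath H (p ++ʷ q)
  ++ʷ-isPath stop q _ q! _ = q!
  ++ʷ-isPath (step e J p) q p!@(_ ∷ p-tail!) q! meet =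
    ¬Any⇒All¬ _ u∉ ∷ ++ʷ-isPath p q p-tail! q! (λ x∈ → meet (there x∈))
    where
    u∉ : _ ∉ verts H (p ++ʷ q)
    u∉ u∈ with ∈-verts-++ʷ⁻ p q u∈
    ... | inj₁ u∈p = Unique[x∷xs]⇒x∉xs p! u∈p
    ... | inj₂ u∈q =
      Unique[x∷xs]⇒x∉xs p! (subst (_∈ _) (sym (meet (here refl) u∈q)) (end∈verts p))

  InSub-++ʷ : ∀ {S u v w} (p : Walk H u v) (q : Walk H v w) → InSub H S p → InSub H S q →
    InSub H S (p ++ʷ q)
  InSub-++ʷ p q (p-vs , p-es) (q-vs , q-es) =
    All.tabulate (λ x∈ → [ All.lookup p-vs , All.lookup q-vs ]′ (∈-verts-++ʷ⁻ p q x∈)) ,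
    subst (All _) (sym (edgesOf-++ʷ p q)) (All.++⁺ p-es q-es)

  snocʷ : ∀ {u v w} → Walk H u v → (e : E) → Joins H e v w → Walk H u w
  snocʷ p e J = p ++ʷ step e J stop

  reverseʷ : ∀ {u v} → Walk H u v → Walk H v u
  reverseʷ stop = stop
  reverseʷ (step e J p) = snocʷ (reverseʷ p) e (swap J)

  verts-snocʷ : ∀ {u v w} (p : Walk H u v) e (J : Joins H e v w) →
    verts H (snocʷ p e J) ≡ verts H p ++ [ w ]
  verts-snocʷ stop e J = refl
  verts-snocʷ {u} (step _ _ p) e J = cong (u ∷_) (verts-snocʷ p e J)

  verts-reverseʷ : ∀ {u v} (p : Walk H u v) → verts H (reverseʷ p) ≡ reverse (verts H p)
  verts-reverseʷ stop = refl
  verts-reverseʷ {u} (step e J p) = begin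
    verts H (snocʷ (reverseʷ p) e (swap J)) ≡⟨ verts-snocʷ (reverseʷ p) e (swap J) ⟩
    verts H (reverseʷ p) ++ [ u ]            ≡⟨ cong (_++ [ u ]) (verts-reverseʷ p) ⟩
    reverse (verts H p) ++ [ u ]             ≡⟨ unfold-reverse u (verts H p) ⟨
    reverse (u ∷ verts H p)                  ∎
    where open ≡-Reasoning

  edgesOf-reverseʷ : ∀ {u v} (p : Walk H u v) → edgesOf H (reverseʷ p) ≡ reverse (edgesOf H p)
  edgesOf-reverseʷ stop = refl
  edgesOf-reverseʷ (step e J p) = begin
    edgesOf H (snocʷ (reverseʷ p) e (swap J))   ≡⟨ edgesOf-++ʷ (reverseʷ p) (step e (swap J) stop) ⟩
    edgesOf H (reverseʷ p) ++ [ e ]             ≡⟨ cong (_++ [ e ]) (edgesOf-reverseʷ p) ⟩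
    reverse (edgesOf H p) ++ [ e ]              ≡⟨ unfold-reverse e (edgesOf H p) ⟨
    reverse (e ∷ edgesOf H p)                   ∎
    where open ≡-Reasoning

  ∈-verts-reverseʷ⁻ : ∀ {u v x} (p : Walk H u v) → x ∈ verts H (reverseʷ p) → x ∈ verts H p
  ∈-verts-reverseʷ⁻ p x∈ = Any.reverse⁻ (subst (_ ∈_) (verts-reverseʷ p) x∈)

  ∈-edgesOf-reverseʷ⁻ : ∀ {u v e} (p : Walk H u v) → e ∈ edgesOf H (reverseʷ p) → e ∈ edgesOf H p
  ∈-edgesOf-reverseʷ⁻ p e∈ = Any.reverse⁻ (subst (_ ∈_) (edgesOf-reverseʷ p) e∈)

  ∈-edgesOf-reverseʷ⁺ : ∀ {u v e} (p : Walk H u v) → e ∈ edgesOf H p → e ∈ edgesOf H (reverseʷ p)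
  ∈-edgesOf-reverseʷ⁺ p e∈ = subst (_ ∈_) (sym (edgesOf-reverseʷ p)) (Any.reverse⁺ e∈)

  reverseʷ-isPath : ∀ {u v} (p : Walk H u v) → IsPath H p → IsPath H (reverseʷ p)
  reverseʷ-isPath p p! = subst Unique (sym (verts-reverseʷ p)) (Unique-reverse (verts H p) p!)

  InSub-reverseʷ : ∀ {S u v} (p : Walk H u v) → InSub H S p → InSub H S (reverseʷ p)
  InSub-reverseʷ p = InSub-mono (∈-verts-reverseʷ⁻ p) (∈-edgesOf-reverseʷ⁻ p)

  data Suffix {w} : ∀ {u v} → Walk H v w → Walk H u w → Set where
    here  : ∀ {u} {p : Walk H u w} → Suffix p p
    there : ∀ {u u₁ v e} {J : Joins H e u u₁} {p : Walk H v w} {q} → Suffix p q → Suffix p (step e J q)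

  ++ʷ-Suffix : ∀ {u v w} (p : Walk H u v) (q : Walk H v w) → Suffix q (p ++ʷ q)
  ++ʷ-Suffix stop q = here
  ++ʷ-Suffix (step _ _ p) q = there (++ʷ-Suffix p q)

  Suffix-verts : ∀ {u v w} {p : Walk H v w} {q : Walk H u w} → Suffix p q → verts H p ⊆ verts H q
  Suffix-verts here x∈ = x∈
  Suffix-verts (there sfx) x∈ = there (Suffix-verts sfx x∈)

  Suffix-edgesOf : ∀ {u v w} {p : Walk H v w} {q : Walk H u w} → Suffix p q → edgesOf H p ⊆ edgesOf H q
  Suffix-edgesOf here e∈ = e∈
  Suffix-edgesOf (there sfx) e∈ = there (Suffix-edgesOf sfx e∈)

  Suffix-isPath : ∀ {u v w} {p : Walk H v w} {q : Walk H u w} → Suffix p q → IsPath H q → IsPath H p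
  Suffix-isPath here q! = q!
  Suffix-isPath (there sfx) (_ ∷ q!) = Suffix-isPath sfx q!

  Suffix-length : ∀ {u v w} {p : Walk H v w} {q : Walk H u w} → Suffix p q →
    length (edgesOf H p) ≤ length (edgesOf H q)
  Suffix-length here = ≤-refl
  Suffix-length (there sfx) = m≤n⇒m≤1+n (Suffix-length sfx)

module Subdivision {V E : Set} (G : Graph V E) (s : E → ℕ) where

  -- Points of a subdivided edge

  V' : Set
  V' = SubV {V} s

  E' : Set
  E' = SubE {V} s

  G' : Graph V' E'
  G' = subdivide s G

  end₁ end₂ : E → V
  end₁ e = proj₁ (ends G e)
  end₂ e = proj₂ (ends G e)

  pt : E → ℕ → V'
  pt e = point s e (ends G e)

  pt-interior : ∀ {e i} (i<s : i < s e) → pt e (suc i) ≡ inj₂ (e , fromℕ< i<s)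
  pt-interior {e} {i} i<s with i <? s e
  ... | yes _ = refl
  ... | no i≮s = contradiction i<s i≮s

  pt-last : ∀ e → pt e (suc (s e)) ≡ inj₁ (end₂ e)
  pt-last e with s e <? s e
  ... | yes s<s = contradiction s<s (<-irrefl refl)
  ... | no _ = refl

  pt-toℕ : ∀ {e} (t : Fin (s e)) → pt e (suc (toℕ t)) ≡ inj₂ (e , t)
  pt-toℕ t = trans (pt-interior (toℕ<n t)) (cong (λ t → inj₂ (_ , t)) (fromℕ<-toℕ t _))

  pt≡inj₂ : ∀ {e} j {x} → pt e j ≡ inj₂ x → e ≡ proj₁ x × j ≡ suc (toℕ (proj₂ x))
  pt≡inj₂ zero ()
  pt≡inj₂ {e} (suc j) eq with j <? s e
  pt≡inj₂ (suc j) refl | yes j<s = refl , cong suc (sym (toℕ-fromℕ< j<s))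
  pt≡inj₂ (suc j) () | no _

  pt≡inj₁ : ∀ {e} j {v} → j ≤ suc (s e) → pt e j ≡ inj₁ v →
    (j ≡ 0 × end₁ e ≡ v) ⊎ (j ≡ suc (s e) × end₂ e ≡ v)
  pt≡inj₁ zero _ refl = inj₁ (refl , refl)
  pt≡inj₁ {e} (suc j) j≤ eq with j <? s e
  pt≡inj₁ (suc j) j≤ () | yes _
  pt≡inj₁ (suc j) (s≤s j≤) refl | no j≮s with m≤n⇒m<n∨m≡n j≤
  ... | inj₁ j<s = contradiction j<s j≮s
  ... | inj₂ j≡s = inj₂ (cong suc j≡s , refl)

  pt-injective : Loopless G → ∀ {e i j} → i ≤ suc (s e) → j ≤ suc (s e) → pt e i ≡ pt e j → i ≡ j
  pt-injective loopless {e} {zero} _ j≤ eq with pt≡inj₁ _ j≤ (sym eq)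
  ... | inj₁ (j≡0 , _) = sym j≡0
  ... | inj₂ (_ , e₂≡e₁) = contradiction (sym e₂≡e₁) (loopless e)
  pt-injective loopless {e} {suc i} (s≤s i≤) j≤ eq with m≤n⇒m<n∨m≡n i≤
  ... | inj₁ i<s =
    sym (trans (proj₂ (pt≡inj₂ _ (trans (sym eq) (pt-interior i<s)))) (cong suc (toℕ-fromℕ< i<s)))
  ... | inj₂ refl with pt≡inj₁ _ j≤ (trans (sym eq) (pt-last e))
  ...   | inj₁ (_ , e₁≡e₂) = contradiction e₁≡e₂ (loopless e)
  ...   | inj₂ (j≡ , _) = sym j≡

  OnChain : E → V' → Set
  OnChain e (inj₁ v) = Incident G e v
  OnChain e (inj₂ (f , _)) = f ≡ e

  pt-OnChain : ∀ e j → OnChain e (pt e j)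
  pt-OnChain e zero = inj₁ refl
  pt-OnChain e (suc j) with j <? s e
  ... | yes _ = refl
  ... | no _ = inj₂ refl

  inj₁≢pt : ∀ {e j v} → 1 ≤ j → j ≤ s e → inj₁ v ≢ pt e j
  inj₁≢pt {j = suc j} _ j<s eq with () ← trans eq (pt-interior j<s)

  pt-neighbours : ∀ {e i ε w} → i < s e → Joins G' ε (pt e (suc i)) w →
    Σ (Fin (suc (s e))) λ t → ε ≡ (e , t) ×
      (toℕ t ≡ i × w ≡ pt e i ⊎ toℕ t ≡ suc i × w ≡ pt e (suc (suc i)))
  pt-neighbours {e} {i} {f , t} i<s (inj₁ eq)
    with refl , t≡ ← pt≡inj₂ (toℕ t) (trans (cong proj₁ eq) (pt-interior i<s)) =
    t , refl , inj₂ (t≡1+i , trans (sym (cong proj₂ eq)) (cong (pt e ∘ suc) t≡1+i))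
    where t≡1+i = trans t≡ (cong suc (toℕ-fromℕ< i<s))
  pt-neighbours {e} {i} {f , t} i<s (inj₂ eq)
    with refl , t≡ ← pt≡inj₂ (suc (toℕ t)) (trans (cong proj₂ eq) (pt-interior i<s)) =
    t , refl , inj₁ (t≡i , trans (sym (cong proj₁ eq)) (cong (pt e) t≡i))
    where t≡i = trans (suc-injective t≡) (toℕ-fromℕ< i<s)

  -- Lifting walks of G

  record Crosses (e : E) {u' y'} (Q' : Walk G' u' y') {z} (W : Walk G' (inj₁ z) y') : Set where
    field
      suffix       : Suffix W Q'
      prefix-verts : ∀ {v} → v ∈ verts G' Q' → OnChain e v ⊎ v ∈ verts G' W
      prefix-edges : ∀ {ε} → ε ∈ edgesOf G' Q' → proj₁ ε ≡ e ⊎ ε ∈ edgesOf G' W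
  open Crosses

  Crosses-here : ∀ {e u' y' z} → u' ≡ inj₁ z → (Q' : Walk G' u' y') →
    Σ (Walk G' (inj₁ z) y') (Crosses e Q')
  Crosses-here refl Q' = Q' , record { suffix = here ; prefix-verts = inj₂ ; prefix-edges = inj₂ }

  Crosses-step : ∀ {e u' w y' z ε} {J : Joins G' ε u' w} {Q' : Walk G' w y'} {W : Walk G' (inj₁ z) y'} →
    OnChain e u' → proj₁ ε ≡ e → Crosses e Q' W → Crosses e (step ε J Q') W
  Crosses-step u'-on ε-on c = record
    { suffix       = there (suffix c)
    ; prefix-verts = λ { (here refl) → inj₁ u'-on ; (there v∈) → prefix-verts c v∈ }
    ; prefix-edges = λ { (here refl) → inj₁ ε-on ; (there ε∈) → prefix-edges c ε∈ }
    }

  -- The start is given up to an equation because pt e i does not compute for a variable i.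
  descend : ∀ e i → i ≤ suc (s e) → ∀ {u'} → u' ≡ pt e i → Walk G' u' (inj₁ (end₁ e))
  descend e zero _ refl = stop
  descend e (suc i) i<1+s refl =
    step (e , fromℕ< i<1+s) (inj₂ (cong (λ j → pt e j , pt e (suc j)) (toℕ-fromℕ< i<1+s)))
      (descend e i (<⇒≤ i<1+s) refl)

  module _ {e : E} where

    descend-verts : ∀ i (i≤ : i ≤ suc (s e)) {u'} (u'≡ : u' ≡ pt e i) {v} →
      v ∈ verts G' (descend e i i≤ u'≡) → ∃ λ j → j ≤ i × v ≡ pt e j
    descend-verts zero _ refl (here refl) = zero , z≤n , refl
    descend-verts (suc i) _ refl (here refl) = suc i , ≤-refl , refl
    descend-verts (suc i) i< refl (there v∈) with j , j≤i , refl ← descend-verts i (<⇒≤ i<) refl v∈ =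
      j , m≤n⇒m≤1+n j≤i , refl

    descend-OnChain : ∀ i (i≤ : i ≤ suc (s e)) {u'} (u'≡ : u' ≡ pt e i) {v} →
      v ∈ verts G' (descend e i i≤ u'≡) → OnChain e v
    descend-OnChain i i≤ u'≡ v∈ with j , _ , refl ← descend-verts i i≤ u'≡ v∈ = pt-OnChain e j

    descend-edges : ∀ i (i≤ : i ≤ suc (s e)) {u'} (u'≡ : u' ≡ pt e i) {ε} →
      ε ∈ edgesOf G' (descend e i i≤ u'≡) → proj₁ ε ≡ e
    descend-edges (suc i) _ refl (here refl) = refl
    descend-edges (suc i) i< refl (there ε∈) = descend-edges i (<⇒≤ i<) refl ε∈

    descend-covers : ∀ i (i≤ : i ≤ suc (s e)) {u'} (u'≡ : u' ≡ pt e i) t →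
      toℕ t < i → (e , t) ∈ edgesOf G' (descend e i i≤ u'≡)
    descend-covers (suc i) i< refl t t<1+i with m≤n⇒m<n∨m≡n (≤-pred t<1+i)
    ... | inj₁ t<i = there (descend-covers i (<⇒≤ i<) refl t t<i)
    ... | inj₂ t≡i = here (cong (e ,_) (toℕ-injective (trans t≡i (sym (toℕ-fromℕ< i<)))))

    descend-isPath : Loopless G → ∀ i (i≤ : i ≤ suc (s e)) {u'} (u'≡ : u' ≡ pt e i) →
      IsPath G' (descend e i i≤ u'≡)
    descend-isPath _ zero _ refl = [] ∷ []
    descend-isPath loopless (suc i) i< refl =
      ¬Any⇒All¬ _ top∉ ∷ descend-isPath loopless i (<⇒≤ i<) refl
      where
      top∉ : pt e (suc i) ∉ verts G' (descend e i (<⇒≤ i<) refl)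
      top∉ v∈ with j , j≤i , eq ← descend-verts i (<⇒≤ i<) refl v∈ =
        contradiction (pt-injective loopless i< (≤-trans j≤i (<⇒≤ i<)) eq) (<⇒≢ (s≤s j≤i) ∘ sym)

  module _ (e : E) where

    edgeChain : Walk G' (inj₁ (end₂ e)) (inj₁ (end₁ e))
    edgeChain = descend e (suc (s e)) ≤-refl (sym (pt-last e))

    edgeChain-verts : ∀ {v} → v ∈ verts G' edgeChain → OnChain e v
    edgeChain-verts = descend-OnChain (suc (s e)) ≤-refl (sym (pt-last e))

    edgeChain-edges : ∀ {ε} → ε ∈ edgesOf G' edgeChain → proj₁ ε ≡ e
    edgeChain-edges = descend-edges (suc (s e)) ≤-refl (sym (pt-last e))

    edgeChain-covers : ∀ t → (e , t) ∈ edgesOf G' edgeChain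
    edgeChain-covers t = descend-covers (suc (s e)) ≤-refl (sym (pt-last e)) t (toℕ<n t)

    edgeChain-isPath : Loopless G → IsPath G' edgeChain
    edgeChain-isPath loopless = descend-isPath loopless (suc (s e)) ≤-refl (sym (pt-last e))

  chain : ∀ {e x z} → Joins G e x z → Walk G' (inj₁ x) (inj₁ z)
  chain {e} (inj₁ refl) = reverseʷ (edgeChain e)
  chain {e} (inj₂ refl) = edgeChain e

  module _ {e : E} {x z : V} where

    chain-verts : (J : Joins G e x z) → ∀ {v} → v ∈ verts G' (chain J) → OnChain e v
    chain-verts (inj₁ refl) = edgeChain-verts e ∘ ∈-verts-reverseʷ⁻ (edgeChain e)
    chain-verts (inj₂ refl) = edgeChain-verts e

    chain-edges : (J : Joins G e x z) → ∀ {ε} → ε ∈ edgesOf G' (chain J) → proj₁ ε ≡ e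
    chain-edges (inj₁ refl) = edgeChain-edges e ∘ ∈-edgesOf-reverseʷ⁻ (edgeChain e)
    chain-edges (inj₂ refl) = edgeChain-edges e

    chain-covers : (J : Joins G e x z) → ∀ t → (e , t) ∈ edgesOf G' (chain J)
    chain-covers (inj₁ refl) = ∈-edgesOf-reverseʷ⁺ (edgeChain e) ∘ edgeChain-covers e
    chain-covers (inj₂ refl) = edgeChain-covers e

    chain-isPath : Loopless G → (J : Joins G e x z) → IsPath G' (chain J)
    chain-isPath loopless (inj₁ refl) = reverseʷ-isPath (edgeChain e) (edgeChain-isPath e loopless)
    chain-isPath loopless (inj₂ refl) = edgeChain-isPath e loopless

  record Traces {x y} (P : Walk G x y) (P' : Walk G' (inj₁ x) (inj₁ y)) : Set where
    field
      orig⁻ : ∀ {v} → inj₁ v ∈ verts G' P' → v ∈ verts G P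
      orig⁺ : ∀ {v} → v ∈ verts G P → inj₁ v ∈ verts G' P'
      sub⁻  : ∀ {e t} → inj₂ (e , t) ∈ verts G' P' → e ∈ edgesOf G P
      edge⁻ : ∀ {ε} → ε ∈ edgesOf G' P' → proj₁ ε ∈ edgesOf G P
      edge⁺ : ∀ {e} → e ∈ edgesOf G P → ∀ t → (e , t) ∈ edgesOf G' P'
  open Traces

  traces-stop : ∀ {x} → Traces (stop {u = x}) stop
  traces-stop = record
    { orig⁻ = λ { (here refl) → here refl }
    ; orig⁺ = λ { (here refl) → here refl }
    ; sub⁻  = λ { (here ()) }
    ; edge⁻ = λ ()
    ; edge⁺ = λ ()
    }

  traces-step : ∀ {x z y e} (J : Joins G e x z) {P : Walk G z y} {Q' : Walk G' (inj₁ x) (inj₁ y)}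
    {W : Walk G' (inj₁ z) (inj₁ y)} → Crosses e Q' W → (∀ t → (e , t) ∈ edgesOf G' Q') →
    Traces P W → Traces (step e J P) Q'
  traces-step J {P} {Q'} c covers tr = record
    { orig⁻ = orig⁻′ ; orig⁺ = orig⁺′ ; sub⁻ = sub⁻′ ; edge⁻ = edge⁻′ ; edge⁺ = edge⁺′ }
    where
    orig⁻′ : ∀ {v} → inj₁ v ∈ verts G' Q' → v ∈ verts G (step _ J P)
    orig⁻′ v∈ with prefix-verts c v∈
    ... | inj₂ v∈W = there (orig⁻ tr v∈W)
    ... | inj₁ e∋v with Incident-Joins G J e∋v
    ...   | inj₁ refl = here refl
    ...   | inj₂ refl = there (start∈verts P)
    orig⁺′ : ∀ {v} → v ∈ verts G (step _ J P) → inj₁ v ∈ verts G' Q'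
    orig⁺′ (here refl) = start∈verts Q'
    orig⁺′ (there v∈) = Suffix-verts (suffix c) (orig⁺ tr v∈)
    sub⁻′ : ∀ {f t} → inj₂ (f , t) ∈ verts G' Q' → f ∈ edgesOf G (step _ J P)
    sub⁻′ v∈ with prefix-verts c v∈
    ... | inj₁ refl = here refl
    ... | inj₂ v∈W = there (sub⁻ tr v∈W)
    edge⁻′ : ∀ {ε} → ε ∈ edgesOf G' Q' → proj₁ ε ∈ edgesOf G (step _ J P)
    edge⁻′ ε∈ with prefix-edges c ε∈
    ... | inj₁ ε-on = here ε-on
    ... | inj₂ ε∈W = there (edge⁻ tr ε∈W)
    edge⁺′ : ∀ {f} → f ∈ edgesOf G (step _ J P) → ∀ t → (f , t) ∈ edgesOf G' Q'
    edge⁺′ (here refl) = covers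
    edge⁺′ (there f∈) t = Suffix-edgesOf (suffix c) (edge⁺ tr f∈ t)

  subdivideWalk : ∀ {x y} → Walk G x y → Walk G' (inj₁ x) (inj₁ y)
  subdivideWalk stop = stop
  subdivideWalk (step e J P) = chain J ++ʷ subdivideWalk P

  subdivideWalk-traces : ∀ {x y} (P : Walk G x y) → Traces P (subdivideWalk P)
  subdivideWalk-traces stop = traces-stop
  subdivideWalk-traces (step e J P) =
    traces-step J crosses covers (subdivideWalk-traces P)
    where
    W = subdivideWalk P
    covers : ∀ t → (e , t) ∈ edgesOf G' (chain J ++ʷ W)
    covers t = subst (_ ∈_) (sym (edgesOf-++ʷ (chain J) W)) (∈-++⁺ˡ (chain-covers J t))
    crosses : Crosses e (chain J ++ʷ W) W
    crosses = record
      { suffix       = ++ʷ-Suffix (chain J) W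
      ; prefix-verts = Sum.map₁ (chain-verts J) ∘ ∈-verts-++ʷ⁻ (chain J) W
      ; prefix-edges = Sum.map₁ (chain-edges J) ∘ ∈-++⁻ _ ∘ subst (_ ∈_) (edgesOf-++ʷ (chain J) W)
      }

  subdivideWalk-isPath : Loopless G → ∀ {x y} (P : Walk G x y) → IsPath G P →
    IsPath G' (subdivideWalk P)
  subdivideWalk-isPath _ stop _ = [] ∷ []
  subdivideWalk-isPath loopless (step e J P) P!@(_ ∷ tail!) =
    ++ʷ-isPath (chain J) W (chain-isPath loopless J) (subdivideWalk-isPath loopless P tail!) meet
    where
    W = subdivideWalk P
    x∉P = Unique[x∷xs]⇒x∉xs P!
    meet : ∀ {v} → v ∈ verts G' (chain J) → v ∈ verts G' W → v ≡ inj₁ _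
    meet {inj₁ v} v∈c v∈W with Incident-Joins G J (chain-verts J v∈c)
    ... | inj₁ refl = contradiction (orig⁻ (subdivideWalk-traces P) v∈W) x∉P
    ... | inj₂ refl = refl
    meet {inj₂ (f , t)} v∈c v∈W with refl ← chain-verts J v∈c =
      contradiction (Joins-∈verts P J (sub⁻ (subdivideWalk-traces P) v∈W)) x∉P

  -- Contracting paths of G'

  Avoids : E → ℕ → ∀ {u' y'} → Walk G' u' y' → Set
  Avoids e i Q' = ∀ t → toℕ t ≡ i → (e , t) ∉ edgesOf G' Q'

  head-avoided : ∀ {e t u' w y'} (J : Joins G' (e , t) u' w) {Q' : Walk G' w y'} →
    IsPath G' (step (e , t) J Q') → Avoids e (toℕ t) Q'
  head-avoided J {Q'} Q'! t′ t′≡ ε∈ =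
    Unique[x∷xs]⇒x∉xs Q'! (Joins-∈verts Q' J (subst (λ t → (_ , t) ∈ _) (toℕ-injective t′≡) ε∈))

  -- Inner points of a subdivided edge have degree 2, so the path is forced up to end₂ e.
  -- Avoidance is required of the edge below the start rather than of its lower end, so that
  -- the path may end there, as it does in AvoidingPath-cycle.
  exitUp : ∀ {e i u' y'} → i ≤ s e → u' ≡ pt e (suc i) → (Q' : Walk G' u' y') → IsPath G' Q' →
    Avoids e i Q' → (∀ {j} → suc i ≤ j → j ≤ s e → y' ≢ pt e j) →
    Σ (Walk G' (inj₁ (end₂ e)) y') λ W → Crosses e Q' W × (∀ t → i < toℕ t → (e , t) ∈ edgesOf G' Q')
  exitUp {e} {i} i≤s u'≡ Q' _ _ _ with m≤n⇒m<n∨m≡n i≤s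
  ... | inj₂ refl with W , c ← Crosses-here (trans u'≡ (pt-last e)) Q' =
    W , c , λ t s<t → contradiction s<t (≤⇒≯ (toℕ≤pred[n] t))
  exitUp _ refl stop _ _ y'≢ | inj₁ i<s = contradiction refl (y'≢ ≤-refl i<s)
  exitUp {e} {i} _ refl (step ε J Q') Q'!@(_ ∷ tail!) avoid y'≢ | inj₁ i<s with pt-neighbours i<s J
  ... | t , refl , inj₁ (t≡i , _) = contradiction (here refl) (avoid t t≡i)
  ... | t , refl , inj₂ (t≡1+i , refl) =
    let W , c , covers = exitUp i<s refl Q' tail! avoid′ (λ j≥ → y'≢ (≤-trans (n≤1+n _) j≥))
    in  W , Crosses-step (pt-OnChain e (suc i)) refl c , covers′ covers
    where
    avoid′ : Avoids e (suc i) Q'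
    avoid′ t′ t′≡ ε∈ =
      Unique[x∷xs]⇒x∉xs Q'! (subst (_∈ _) (cong (pt e) t′≡) (proj₁ (ends∈verts Q' ε∈)))
    covers′ : (∀ t′ → suc i < toℕ t′ → (e , t′) ∈ edgesOf G' Q') →
      ∀ t′ → i < toℕ t′ → (e , t′) ∈ edgesOf G' (step (e , t) J Q')
    covers′ covers t′ i<t′ with m≤n⇒m<n∨m≡n i<t′
    ... | inj₁ 1+i<t′ = there (covers t′ 1+i<t′)
    ... | inj₂ 1+i≡t′ = here (cong (e ,_) (toℕ-injective (trans (sym 1+i≡t′) (sym t≡1+i))))

  exitDown : ∀ {e i u' y'} → i ≤ s e → u' ≡ pt e i → (Q' : Walk G' u' y') → IsPath G' Q' →
    Avoids e i Q' → (∀ {j} → 1 ≤ j → j ≤ i → y' ≢ pt e j) →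
    Σ (Walk G' (inj₁ (end₁ e)) y') λ W → Crosses e Q' W × (∀ t → toℕ t < i → (e , t) ∈ edgesOf G' Q')
  exitDown {i = zero} _ u'≡ Q' _ _ _ with W , c ← Crosses-here u'≡ Q' = W , c , λ _ ()
  exitDown {i = suc i} _ refl stop _ _ y'≢ = contradiction refl (y'≢ (s≤s z≤n) ≤-refl)
  exitDown {e} {suc i} i<s refl (step ε J Q') Q'!@(_ ∷ tail!) avoid y'≢ with pt-neighbours i<s J
  ... | t , refl , inj₂ (t≡1+i , _) = contradiction (here refl) (avoid t t≡1+i)
  ... | t , refl , inj₁ (t≡i , refl) =
    let W , c , covers =
          exitDown (<⇒≤ i<s) refl Q' tail! avoid′ (λ 1≤j j≤i → y'≢ 1≤j (m≤n⇒m≤1+n j≤i))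
    in  W , Crosses-step (pt-OnChain e (suc i)) refl c , covers′ covers
    where
    avoid′ : Avoids e i Q'
    avoid′ t′ t′≡ ε∈ =
      Unique[x∷xs]⇒x∉xs Q'! (subst (_∈ _) (cong (pt e ∘ suc) t′≡) (proj₂ (ends∈verts Q' ε∈)))
    covers′ : (∀ t′ → toℕ t′ < i → (e , t′) ∈ edgesOf G' Q') →
      ∀ t′ → toℕ t′ < suc i → (e , t′) ∈ edgesOf G' (step (e , t) J Q')
    covers′ covers t′ t′<1+i with m≤n⇒m<n∨m≡n (≤-pred t′<1+i)
    ... | inj₁ t′<i = there (covers t′ t′<i)
    ... | inj₂ t′≡i = here (cong (e ,_) (toℕ-injective (trans t′≡i (sym t≡i))))

  crossFirstEdge : ∀ {x y ε w} (J : Joins G' ε (inj₁ x) w) (Q' : Walk G' w (inj₁ y)) →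
    IsPath G' (step ε J Q') →
    Σ V λ z → Joins G (proj₁ ε) x z × Σ (Walk G' (inj₁ z) (inj₁ y)) λ W →
      Crosses (proj₁ ε) Q' W × (∀ t → (proj₁ ε , t) ∈ edgesOf G' (step ε J Q'))
  crossFirstEdge {ε = e , t} J@(inj₁ eq) Q' Q'!@(_ ∷ tail!)
    with pt≡inj₁ (toℕ t) (<⇒≤ (toℕ<n t)) (cong proj₁ eq)
  ... | inj₂ (t≡1+s , _) = contradiction t≡1+s (<⇒≢ (toℕ<n t))
  ... | inj₁ (t≡0 , e₁≡x) =
    let W , c , covers = exitUp (toℕ≤pred[n] t) (sym (cong proj₂ eq)) Q' tail! (head-avoided J Q'!)
                           (λ 1+t≤j j≤s → inj₁≢pt (≤-trans (s≤s z≤n) 1+t≤j) j≤s)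
    in  end₂ e , inj₁ (cong (_, end₂ e) e₁≡x) , W , c , covers′ covers
    where
    covers′ : (∀ t′ → toℕ t < toℕ t′ → (e , t′) ∈ edgesOf G' Q') →
      ∀ t′ → (e , t′) ∈ edgesOf G' (step (e , t) J Q')
    covers′ covers t′ with m≤n⇒m<n∨m≡n (subst (_≤ toℕ t′) (sym t≡0) z≤n)
    ... | inj₁ t<t′ = there (covers t′ t<t′)
    ... | inj₂ t≡t′ = here (cong (e ,_) (toℕ-injective (sym t≡t′)))
  crossFirstEdge {ε = e , t} J@(inj₂ eq) Q' Q'!@(_ ∷ tail!)
    with pt≡inj₁ (suc (toℕ t)) (s≤s (toℕ≤pred[n] t)) (cong proj₂ eq)
  ... | inj₁ (() , _)
  ... | inj₂ (1+t≡1+s , e₂≡x) =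
    let W , c , covers = exitDown (toℕ≤pred[n] t) (sym (cong proj₁ eq)) Q' tail! (head-avoided J Q'!)
                           (λ 1≤j j≤t → inj₁≢pt 1≤j (≤-trans j≤t (toℕ≤pred[n] t)))
    in  end₁ e , inj₂ (cong (end₁ e ,_) e₂≡x) , W , c , covers′ covers
    where
    covers′ : (∀ t′ → toℕ t′ < toℕ t → (e , t′) ∈ edgesOf G' Q') →
      ∀ t′ → (e , t′) ∈ edgesOf G' (step (e , t) J Q')
    covers′ covers t′
      with m≤n⇒m<n∨m≡n (subst (toℕ t′ ≤_) (sym (suc-injective 1+t≡1+s)) (toℕ≤pred[n] t′))
    ... | inj₁ t′<t = there (covers t′ t′<t)
    ... | inj₂ t′≡t = here (cong (e ,_) (toℕ-injective t′≡t))

  contractPath : ∀ {x y} (P' : Walk G' (inj₁ x) (inj₁ y)) → IsPath G' P' →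
    Σ (Walk G x y) λ P → IsPath G P × Traces P P'
  contractPath P' P'! = go P' P'! (<-wellFounded _)
    where
    go : ∀ {x y} (P' : Walk G' (inj₁ x) (inj₁ y)) → IsPath G' P' →
      Acc _<_ (length (edgesOf G' P')) → Σ (Walk G x y) λ P → IsPath G P × Traces P P'
    go stop _ _ = stop , [] ∷ [] , traces-stop
    go (step ε J Q') P'!@(_ ∷ tail!) (acc shorter) =
      let z , J₀ , W , c , covers = crossFirstEdge J Q' P'!
          P , P! , tr = go W (Suffix-isPath (suffix c) tail!) (shorter (s≤s (Suffix-length (suffix c))))
      in  step (proj₁ ε) J₀ P ,
          ¬Any⇒All¬ _ (λ x∈P → Unique[x∷xs]⇒x∉xs P'! (Suffix-verts (suffix c) (orig⁺ tr x∈P))) ∷ P! ,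
          traces-step J₀ (Crosses-step (Joins-Incident G J₀) refl c) covers tr

  -- Subdivided trees and CISTs

  module _ (T : Subgraph V E) where

    private
      T' = subdivideSub s T

    InSub-traces⁻ : ∀ {x y} {P : Walk G x y} {P'} → Traces P P' → InSub G' T' P' → InSub G T P
    InSub-traces⁻ tr (P'-vs , P'-es) =
      All.tabulate (All.lookup P'-vs ∘ orig⁺ tr) ,
      All.tabulate (λ e∈ → All.lookup P'-es (edge⁺ tr e∈ zero))

    InSub-traces⁺ : ∀ {x y} {P : Walk G x y} {P'} → Traces P P' → InSub G T P → InSub G' T' P'
    InSub-traces⁺ {P' = P'} tr (P-vs , P-es) =
      All.tabulate vs′ , All.tabulate (All.lookup P-es ∘ edge⁻ tr)
      where
      vs′ : ∀ {v'} → v' ∈ verts G' P' → vs T' v'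
      vs′ {inj₁ v} v∈ = All.lookup P-vs (orig⁻ tr v∈)
      vs′ {inj₂ _} v∈ = All.lookup P-es (sub⁻ tr v∈)

    module _ (closed : ∀ e → es T e → vs T (end₁ e) × vs T (end₂ e)) where

      OnChain-vs : ∀ {e v'} → es T e → OnChain e v' → vs T' v'
      OnChain-vs {e} {inj₁ _} e∈T (inj₁ refl) = proj₁ (closed e e∈T)
      OnChain-vs {e} {inj₁ _} e∈T (inj₂ refl) = proj₂ (closed e e∈T)
      OnChain-vs {v' = inj₂ _} e∈T refl = e∈T

      anchor : ∀ {u'} → vs T' u' → Σ V λ x → vs T x × Σ (Walk G' u' (inj₁ x)) (InSub G' T')
      anchor {inj₁ x} x∈T = x , x∈T , stop , x∈T ∷ [] , []
      anchor {inj₂ (e , t)} e∈T =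
        end₁ e , proj₁ (closed e e∈T) , down ,
        All.tabulate (OnChain-vs e∈T ∘ descend-OnChain i i≤ (sym (pt-toℕ t))) ,
        All.tabulate (λ ε∈ → subst (es T) (sym (descend-edges i i≤ (sym (pt-toℕ t)) ε∈)) e∈T)
        where
        i = suc (toℕ t)
        i≤ = m≤n⇒m≤1+n (toℕ<n t)
        down = descend e i i≤ (sym (pt-toℕ t))

    AvoidingPath : E' → V' → V' → Set
    AvoidingPath ε u' v' = Σ (Walk G' u' v') λ q → IsPath G' q × InSub G' T' q × ε ∉ edgesOf G' q

    AvoidingPath-reverse : ∀ {ε u' v'} → AvoidingPath ε u' v' → AvoidingPath ε v' u'
    AvoidingPath-reverse (q , q! , q-in , ε∉) =
      reverseʷ q , reverseʷ-isPath q q! , InSub-reverseʷ q q-in , ε∉ ∘ ∈-edgesOf-reverseʷ⁻ q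

    AvoidingPath-suffix : ∀ {ε u' v' w'} ((q , _) : AvoidingPath ε u' w') {W : Walk G' v' w'} →
      Suffix W q → AvoidingPath ε v' w'
    AvoidingPath-suffix (q , q! , q-in , ε∉) {W} sfx =
      W , Suffix-isPath sfx q! , InSub-mono (Suffix-verts sfx) (Suffix-edgesOf sfx) q-in ,
      ε∉ ∘ Suffix-edgesOf sfx

    -- Read from the far side of its edge (e , t), the cycle must run up to end₂ e and, from the
    -- other side, down to end₁ e; the part between these two ends contracts to a path avoiding e.
    AvoidingPath-cycle : Loopless G → ∀ {e t} → es T e →
      AvoidingPath (e , t) (pt e (suc (toℕ t))) (pt e (toℕ t)) → HasCycle G T
    AvoidingPath-cycle loopless {e} {t} e∈T q₁@(q , q! , _ , ε∉q) =
      let W₁ , c₁ , _ = exitUp (toℕ≤pred[n] t) refl q q! (avoids q ε∉q) not-ahead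
          r = AvoidingPath-reverse (AvoidingPath-suffix q₁ (suffix c₁))
          R , R! , _ , ε∉R = r
          W₂ , c₂ , _ = exitDown (toℕ≤pred[n] t) refl R R! (avoids R ε∉R)
                          (λ 1≤j j≤t → inj₁≢pt 1≤j (≤-trans j≤t (toℕ≤pred[n] t)))
          _ , W₂! , W₂-in , ε∉W₂ = AvoidingPath-suffix r (suffix c₂)
          P , P! , tr = contractPath W₂ W₂!
      in  end₂ e , end₁ e , e , inj₂ refl , P , e∈T , InSub-traces⁻ tr W₂-in , P! ,
          λ e∈P → ε∉W₂ (edge⁺ tr e∈P t)
      where
      avoids : ∀ {u' v'} (q : Walk G' u' v') → (e , t) ∉ edgesOf G' q → Avoids e (toℕ t) q
      avoids q ε∉ t′ t′≡ = subst (λ t → (e , t) ∉ edgesOf G' q) (toℕ-injective (sym t′≡)) ε∉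
      not-ahead : ∀ {j} → suc (toℕ t) ≤ j → j ≤ s e → pt e (toℕ t) ≢ pt e j
      not-ahead t<j j≤s eq = <⇒≢ t<j (pt-injective loopless (<⇒≤ (toℕ<n t)) (m≤n⇒m≤1+n j≤s) eq)

    HasCycle-subdivide⁻ : Loopless G → HasCycle G' T' → HasCycle G T
    HasCycle-subdivide⁻ loopless (_ , _ , (e , t) , inj₁ refl , q , e∈T , q-in , q! , ε∉) =
      AvoidingPath-cycle loopless e∈T (q , q! , q-in , ε∉)
    HasCycle-subdivide⁻ loopless (_ , _ , (e , t) , inj₂ refl , q , e∈T , q-in , q! , ε∉) =
      AvoidingPath-cycle loopless e∈T (AvoidingPath-reverse (q , q! , q-in , ε∉))

    IsTree-subdivide : Loopless G → IsTree G T → IsTree G' T'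
    IsTree-subdivide loopless tree = record
      { closed    = λ { (e , t) e∈T → OnChain-vs closed e∈T (pt-OnChain e (toℕ t))
                                    , OnChain-vs closed e∈T (pt-OnChain e (suc (toℕ t))) }
      ; nonempty  = inj₁ (proj₁ nonempty) , proj₂ nonempty
      ; connected = connected′
      ; acyclic   = acyclic ∘ HasCycle-subdivide⁻ loopless
      }
      where
      open IsTree tree
      connected′ : ∀ u' v' → vs T' u' → vs T' v' → Σ (Walk G' u' v') (InSub G' T')
      connected′ _ _ u'∈ v'∈ =
        let x , x∈ , to-x , to-x-in = anchor closed u'∈
            y , y∈ , to-y , to-y-in = anchor closed v'∈
            P , P-in = connected x y x∈ y∈
        in  to-x ++ʷ subdivideWalk P ++ʷ reverseʷ to-y ,
            InSub-++ʷ to-x _ to-x-in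
              (InSub-++ʷ (subdivideWalk P) _ (InSub-traces⁺ (subdivideWalk-traces P) P-in)
                (InSub-reverseʷ to-y to-y-in))

    Incident-subdivide⁻ : ∀ {e t v} → Incident G' (e , t) (inj₁ v) →
      (toℕ t ≡ 0 × end₁ e ≡ v) ⊎ (toℕ t ≡ s e × end₂ e ≡ v)
    Incident-subdivide⁻ {t = t} (inj₁ eq) with pt≡inj₁ (toℕ t) (<⇒≤ (toℕ<n t)) eq
    ... | inj₁ at-start = inj₁ at-start
    ... | inj₂ (t≡1+s , _) = contradiction t≡1+s (<⇒≢ (toℕ<n t))
    Incident-subdivide⁻ {t = t} (inj₂ eq) with pt≡inj₁ (suc (toℕ t)) (s≤s (toℕ≤pred[n] t)) eq
    ... | inj₂ (1+t≡1+s , e₂≡v) = inj₂ (suc-injective 1+t≡1+s , e₂≡v)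

    Incident-subdivide⁺ : ∀ {e v} → Incident G e v →
      Σ (Fin (suc (s e))) λ t → Incident G' (e , t) (inj₁ v)
    Incident-subdivide⁺ (inj₁ e₁≡v) = zero , inj₁ (cong inj₁ e₁≡v)
    Incident-subdivide⁺ {e} (inj₂ e₂≡v) =
      fromℕ (s e) ,
      inj₂ (trans (cong (pt e ∘ suc) (toℕ-fromℕ (s e))) (trans (pt-last e) (cong inj₁ e₂≡v)))

    Internal-subdivide⁻ : Loopless G → ∀ {v} → Internal G' T' (inj₁ v) → Internal G T v
    Internal-subdivide⁻ loopless ((e₁ , t₁) , (e₂ , t₂) , ε₁≢ε₂ , e₁∈T , e₂∈T , inc₁ , inc₂) =
      e₁ , e₂ , e₁≢e₂ , e₁∈T , e₂∈T , incident inc₁ , incident inc₂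
      where
      incident : ∀ {e t v} → Incident G' (e , t) (inj₁ v) → Incident G e v
      incident = Sum.map proj₂ proj₂ ∘ Incident-subdivide⁻
      same-end : ∀ {e} {t t′ : Fin (suc (s e))} → toℕ t ≡ toℕ t′ → (e , t) ≢ (e , t′) → ⊥
      same-end t≡t′ t≢t′ = t≢t′ (cong (_ ,_) (toℕ-injective t≡t′))
      e₁≢e₂ : e₁ ≢ e₂
      e₁≢e₂ refl with Incident-subdivide⁻ inc₁ | Incident-subdivide⁻ inc₂
      ... | inj₁ (t₁≡0 , _)  | inj₁ (t₂≡0 , _)  = same-end (trans t₁≡0 (sym t₂≡0)) ε₁≢ε₂
      ... | inj₂ (t₁≡s , _)  | inj₂ (t₂≡s , _)  = same-end (trans t₁≡s (sym t₂≡s)) ε₁≢ε₂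
      ... | inj₁ (_ , e₁≡v) | inj₂ (_ , e₂≡v) = loopless e₁ (trans e₁≡v (sym e₂≡v))
      ... | inj₂ (_ , e₂≡v) | inj₁ (_ , e₁≡v) = loopless e₁ (trans e₁≡v (sym e₂≡v))

    Internal-subdivide⁺ : ∀ {v} → Internal G T v → Internal G' T' (inj₁ v)
    Internal-subdivide⁺ (e₁ , e₂ , e₁≢e₂ , e₁∈T , e₂∈T , inc₁ , inc₂) =
      let t₁ , inc₁′ = Incident-subdivide⁺ inc₁
          t₂ , inc₂′ = Incident-subdivide⁺ inc₂
      in  (e₁ , t₁) , (e₂ , t₂) , e₁≢e₂ ∘ cong proj₁ , e₁∈T , e₂∈T , inc₁′ , inc₂′

    subdivisionVertex-Internal : ∀ {e} (t : Fin (s e)) → es T e → Internal G' T' (inj₂ (e , t))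
    subdivisionVertex-Internal {e} t e∈T =
      (e , inject₁ t) , (e , suc t) , t≢1+t ∘ cong (toℕ ∘ proj₂) , e∈T , e∈T ,
      inj₂ (trans (cong (pt e ∘ suc) (toℕ-inject₁ t)) (pt-toℕ t)) , inj₁ (pt-toℕ t)
      where
      t≢1+t : toℕ (inject₁ t) ≢ suc (toℕ t)
      t≢1+t eq = <⇒≢ ≤-refl (trans (sym (toℕ-inject₁ t)) eq)

    IsSteinerTree-subdivide⁺ : Loopless G → ∀ {R} → IsSteinerTree G R T →
      IsSteinerTree G' (liftR s R) T'
    IsSteinerTree-subdivide⁺ loopless (tree , R⊆T , leaves∈R) =
      IsTree-subdivide loopless tree ,
      (λ { (inj₁ v) v∈R → R⊆T v v∈R }) ,
      λ { (inj₁ v) v∈T leaf → leaves∈R v v∈T (leaf ∘ Internal-subdivide⁺)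
        ; (inj₂ (e , t)) e∈T leaf → leaf (subdivisionVertex-Internal t e∈T) }

    IsSteinerTree-subdivide⁻ : Loopless G → IsTree G T → ∀ {R} →
      IsSteinerTree G' (liftR s R) T' → IsSteinerTree G R T
    IsSteinerTree-subdivide⁻ loopless tree (_ , R⊆T′ , leaves∈R′) =
      tree , (λ v → R⊆T′ (inj₁ v)) ,
      λ v v∈T leaf → leaves∈R′ (inj₁ v) v∈T (leaf ∘ Internal-subdivide⁻ loopless)

  module _ {u v} {P Q : Walk G u v} {P' Q' : Walk G' (inj₁ u) (inj₁ v)}
           (trP : Traces P P') (trQ : Traces Q Q') where

    edgeDisjoint⁺ : (∀ e → e ∈ edgesOf G P → e ∈ edgesOf G Q → ⊥) →
      ∀ ε → ε ∈ edgesOf G' P' → ε ∈ edgesOf G' Q' → ⊥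
    edgeDisjoint⁺ disjoint ε ε∈P' ε∈Q' = disjoint (proj₁ ε) (edge⁻ trP ε∈P') (edge⁻ trQ ε∈Q')

    edgeDisjoint⁻ : (∀ ε → ε ∈ edgesOf G' P' → ε ∈ edgesOf G' Q' → ⊥) →
      ∀ e → e ∈ edgesOf G P → e ∈ edgesOf G Q → ⊥
    edgeDisjoint⁻ disjoint e e∈P e∈Q = disjoint (e , zero) (edge⁺ trP e∈P zero) (edge⁺ trQ e∈Q zero)

    internallyDisjoint⁺ : (∀ e → e ∈ edgesOf G P → e ∈ edgesOf G Q → ⊥) →
      (∀ x → x ∈ verts G P → x ∈ verts G Q → x ≡ u ⊎ x ≡ v) →
      ∀ x' → x' ∈ verts G' P' → x' ∈ verts G' Q' → x' ≡ inj₁ u ⊎ x' ≡ inj₁ v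
    internallyDisjoint⁺ _ disjoint (inj₁ x) x∈P' x∈Q' =
      Sum.map (cong inj₁) (cong inj₁) (disjoint x (orig⁻ trP x∈P') (orig⁻ trQ x∈Q'))
    internallyDisjoint⁺ edge-disjoint _ (inj₂ _) x∈P' x∈Q' =
      ⊥-elim (edge-disjoint _ (sub⁻ trP x∈P') (sub⁻ trQ x∈Q'))

    internallyDisjoint⁻ : (∀ x' → x' ∈ verts G' P' → x' ∈ verts G' Q' → x' ≡ inj₁ u ⊎ x' ≡ inj₁ v) →
      ∀ x → x ∈ verts G P → x ∈ verts G Q → x ≡ u ⊎ x ≡ v
    internallyDisjoint⁻ disjoint x x∈P x∈Q =
      Sum.map inj₁-injective inj₁-injective (disjoint (inj₁ x) (orig⁺ trP x∈P) (orig⁺ trQ x∈Q))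

  module _ (loopless : Loopless G) (R : V → Set) (k : ℕ) (T : Fin k → Subgraph V E)
           (trees : ∀ i → IsTree G (T i)) where

    IsCIST-subdivide⁺ : IsCIST G R k T → IsCIST G' (liftR s R) k (subdivideSub s ∘ T)
    IsCIST-subdivide⁺ (steiner , disjoint) =
      (λ i → IsSteinerTree-subdivide⁺ (T i) loopless (steiner i)) ,
      λ { (inj₁ u) (inj₁ v) u∈R v∈R u≢v i j i≢j P' Q' P'! P'∈Tᵢ Q'! Q'∈Tⱼ →
            let P , P! , trP = contractPath P' P'!
                Q , Q! , trQ = contractPath Q' Q'!
                edge-disjoint , internally-disjoint =
                  disjoint u v u∈R v∈R (u≢v ∘ cong inj₁) i j i≢j P Q
                    P! (InSub-traces⁻ (T i) trP P'∈Tᵢ) Q! (InSub-traces⁻ (T j) trQ Q'∈Tⱼ)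
            in  edgeDisjoint⁺ trP trQ edge-disjoint ,
                internallyDisjoint⁺ trP trQ edge-disjoint internally-disjoint }

    IsCIST-subdivide⁻ : IsCIST G' (liftR s R) k (subdivideSub s ∘ T) → IsCIST G R k T
    IsCIST-subdivide⁻ (steiner , disjoint) =
      (λ i → IsSteinerTree-subdivide⁻ (T i) loopless (trees i) (steiner i)) ,
      λ u v u∈R v∈R u≢v i j i≢j P Q P! P∈Tᵢ Q! Q∈Tⱼ →
        let trP = subdivideWalk-traces P
            trQ = subdivideWalk-traces Q
            edge-disjoint , internally-disjoint =
              disjoint (inj₁ u) (inj₁ v) u∈R v∈R (u≢v ∘ inj₁-injective) i j i≢j
                (subdivideWalk P) (subdivideWalk Q)
                (subdivideWalk-isPath loopless P P!) (InSub-traces⁺ (T i) trP P∈Tᵢ)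
                (subdivideWalk-isPath loopless Q Q!) (InSub-traces⁺ (T j) trQ Q∈Tⱼ)
        in  edgeDisjoint⁻ trP trQ edge-disjoint , internallyDisjoint⁻ trP trQ internally-disjoint

proposition2p4 : ∀ {n m : ℕ} (G : Graph (Fin n) (Fin m)) → Loopless G → Connected G →
    (R : Fin n → Set) → AtLeastTwo R → (s : Fin m → ℕ) →
    (k : ℕ) (T : Fin k → Subgraph (Fin n) (Fin m)) → (∀ i → IsTree G (T i)) →
    IsCIST G R k T ⇔ IsCIST (subdivide s G) (liftR s R) k (λ i → subdivideSub s (T i))
proposition2p4 G loopless _ R _ s k T trees =
  mk⇔ (IsCIST-subdivide⁺ loopless R k T trees) (IsCIST-subdivide⁻ loopless R k T trees)
  where open Subdivision G s
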